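{- For all $t,t',t''\in\mathbb{T}^\infty$: if $t\to^\infty t'$ and $t'\to^\infty t''$ then $t\to^\infty t''$.
   Context: Fix a countably infinite set of variables and a countable set of constructors. $\mathbb{T}^\infty$ is the set of finite and infinite terms (modulo $\alpha$-conversion) generated by $t ::= x \mid c \mid \lambda x.t \mid t\,t \mid \mathrm{case}(t;\{c_k\vec{x}_k \Rightarrow t_k \mid k=1,\dots,n\})$ ($x$ variables, $c,c_k$ constructors). One-step reduction $\to_{\beta\iota}$ is the closure under term contexts of $(\lambda x.t)t' \to t[t'/x]$ and $\mathrm{case}(c_k\vec u;\{c_l\vec x_l\Rightarrow t_l\}) \to t_k[\vec u/\vec x_k]$ ($\vec u,\vec x_k$ of the same length, variables in each $\vec x_l$ pairwise distinct, $c_l$ pairwise distinct); $\to^*$ is its reflexive–transitive closure. Infinitary reduction $\to^\infty$ is the largest relation such that whenever $t\to^\infty t'$ one of the following holds: $t'$ is a variable or constructor and $t\to^*t'$; $t'=\lambda x.r'$, $t\to^*\lambda x.r$ and $r\to^\infty r'$; $t'=r_1'r_2'$, $t\to^*r_1r_2$, $r_1\to^\infty r_1'$ and $r_2\to^\infty r_2'$; $t'=\mathrm{case}(r';\{c_k\vec x_k\Rightarrow r_k'\})$, $t\to^*\mathrm{case}(r;\{c_k\vec x_k\Rightarrow r_k\})$, $r\to^\infty r'$ and $r_k\to^\infty r_k'$ for all $k$. -}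

module Defs where

open import Data.Nat using (ℕ; zero; suc; _<_)
open import Data.Fin using (Fin; toℕ)
open import Data.List using (List; []; _∷_; _++_; [_]; length; map; foldl; lookup)
open import Data.List.Relation.Unary.Unique.Propositional using (Unique)
open import Data.Product using (Σ; _×_; _,_; ∃; proj₁)
open import Data.Unit using (⊤)
open import Relation.Nullary using (¬_)
open import Relation.Binary.PropositionalEquality using (_≡_)
open import Relation.Binary.Construct.Closure.ReflexiveTransitive using (Star)

-- A (possibly infinite) term is represented as a labelled tree: a map
-- from positions (paths from the root, lists of child indices) to node
-- labels.  Variables are de Bruijn indices (so α-equivalent terms are
-- identical); constructors are natural numbers (a countable set).
--   var x    : variable x (de Bruijn index)            -- no children
--   con c    : constructor c                           -- no children
--   lam      : λ x. t        child 0 = t, binds 1 variable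
--   app      : t u           child 0 = t, child 1 = u
--   case cs  : case(t; {c_k x⃗_k ⇒ t_k | k})  with cs = [(c_k , |x⃗_k|)]_k,
--              child 0 = t, child (suc k) = t_k which binds |x⃗_k|
--              variables (the last of x⃗_k is index 0).
-- Only labels at valid positions (see Valid) matter; values at other
-- positions are junk, and terms are compared by _≈_ below.

data Label : Set where
  var  : ℕ → Label
  con  : ℕ → Label
  lam  : Label
  app  : Label
  case : List (ℕ × ℕ) → Label

Term : Set
Term = List ℕ → Label

arity : Label → ℕ
arity (var x)   = 0
arity (con c)   = 0
arity lam       = 1
arity app       = 2
arity (case cs) = suc (length cs)

child : Term → ℕ → Term
child t i p = t (i ∷ p)

Valid : Term → List ℕ → Set
Valid t []      = ⊤
Valid t (i ∷ p) = (i < arity (t [])) × Valid (child t i) p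

_≈_ : Term → Term → Set
t ≈ u = ∀ p → Valid t p → t p ≡ u p

nth-arity : List (ℕ × ℕ) → ℕ → ℕ
nth-arity []             k       = 0
nth-arity ((c , n) ∷ cs) zero    = n
nth-arity ((c , n) ∷ cs) (suc k) = nth-arity cs k

binds : Label → ℕ → ℕ
binds lam       zero    = 1
binds (case cs) (suc k) = nth-arity cs k
binds _         _       = 0

liftʳ : (ℕ → ℕ) → ℕ → ℕ
liftʳ ρ zero    = zero
liftʳ ρ (suc i) = suc (ρ i)

liftʳⁿ : ℕ → (ℕ → ℕ) → ℕ → ℕ
liftʳⁿ zero    ρ = ρ
liftʳⁿ (suc n) ρ = liftʳ (liftʳⁿ n ρ)

relabel : (ℕ → ℕ) → Label → Label
relabel ρ (var x) = var (ρ x)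
relabel ρ l       = l

rename : (ℕ → ℕ) → Term → Term
rename ρ t []      = relabel ρ (t [])
rename ρ t (i ∷ p) = rename (liftʳⁿ (binds (t []) i) ρ) (child t i) p

vt : ℕ → Term
vt x p = var x

liftˢ : (ℕ → Term) → ℕ → Term
liftˢ σ zero    = vt zero
liftˢ σ (suc i) = rename suc (σ i)

liftˢⁿ : ℕ → (ℕ → Term) → ℕ → Term
liftˢⁿ zero    σ = σ
liftˢⁿ (suc n) σ = liftˢ (liftˢⁿ n σ)

substL : (ℕ → Term) → Term → Label → List ℕ → Label
substL σ t (var x) p       = σ x p
substL σ t l       []      = l
substL σ t l       (i ∷ p) = substL (liftˢⁿ (binds l i) σ) (child t i) (child t i []) p

subst : (ℕ → Term) → Term → Term
subst σ t p = substL σ t (t []) p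

_∷ˢ_ : Term → (ℕ → Term) → ℕ → Term
(u ∷ˢ σ) zero    = u
(u ∷ˢ σ) (suc i) = σ i

_[_]₀ : Term → Term → Term
b [ u ]₀ = subst (u ∷ˢ vt) b

-- b[u₁…uₙ/x₁…xₙ] where b binds x₁…xₙ (xₙ has index 0)
_[_]ₙ : Term → List Term → Term
b [ us ]ₙ = subst (foldl (λ σ u → u ∷ˢ σ) vt us) b

data Spine : Term → ℕ → List Term → Set where
  head : ∀ {t c} → t [] ≡ con c → Spine t c []
  arg  : ∀ {t c us} → t [] ≡ app → Spine (child t 0) c us →
         Spine t c (us ++ [ child t 1 ])

data _⟶_ : Term → Term → Set where
  -- (λx.b) a → b[a/x]
  β   : ∀ {t u} → t [] ≡ app → child t 0 [] ≡ lam →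
        u ≈ (child (child t 0) 0 [ child t 1 ]₀) → t ⟶ u
  -- case(c_k u⃗; {c_l x⃗_l ⇒ t_l}) → t_k[u⃗/x⃗_k]
  ι   : ∀ {t u cs c us} → t [] ≡ case cs →
        Unique (map proj₁ cs) →
        Spine (child t 0) c us →
        (k : Fin (length cs)) → lookup cs k ≡ (c , length us) →
        u ≈ (child t (suc (toℕ k)) [ us ]ₙ) → t ⟶ u
  ctx : ∀ {t u} (i : ℕ) → t [] ≡ u [] → i < arity (t []) →
        child t i ⟶ child u i →
        (∀ j → j < arity (t []) → ¬ (j ≡ i) → child t j ≈ child u j) →
        t ⟶ u

_⟶*_ : Term → Term → Set
_⟶*_ = Star _⟶_

-- Infinitary reduction: the largest relation R such that R t t' implies
-- one of the clauses below (given as: ∃ post-fixed point containing (t,t')).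

data Clauses (R : Term → Term → Set) (t t' : Term) : Set where
  var  : ∀ {x s} → t' [] ≡ var x → t ⟶* s → s [] ≡ var x → Clauses R t t'
  con  : ∀ {c s} → t' [] ≡ con c → t ⟶* s → s [] ≡ con c → Clauses R t t'
  lam  : ∀ {s} → t' [] ≡ lam → t ⟶* s → s [] ≡ lam →
         R (child s 0) (child t' 0) → Clauses R t t'
  app  : ∀ {s} → t' [] ≡ app → t ⟶* s → s [] ≡ app →
         R (child s 0) (child t' 0) → R (child s 1) (child t' 1) → Clauses R t t'
  case : ∀ {cs s} → t' [] ≡ case cs → t ⟶* s → s [] ≡ case cs →
         R (child s 0) (child t' 0) →
         (∀ k → k < length cs → R (child s (suc k)) (child t' (suc k))) →
         Clauses R t t'

_⟶∞_ : Term → Term → Set₁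
t ⟶∞ t' = Σ (Term → Term → Set) λ R →
            (∀ a b → R a b → Clauses R a b) × R t t'

-- For post-fixed R₁ ∋ (t,t') and R₂ ∋ (t',t'') the
-- composite "a R₁* b and b R₂ c" is again post-fixed, provided R₁* absorbs the
-- finite reduction b ⟶* s with which every clause of b R₂ c begins.  R₁* is
-- the union of the iterates of an up-to closure adding variables,
-- substitution, agreement of terms, prefixing with ⟶* and the clauses
-- themselves; this closure preserves post-fixedness.  If R a b and b ⟶ b',
-- unfolding R shows that a reduces to a term exhibiting the same redex, whose
-- contractum is a substitution instance of R-related terms; hence a is related
-- to b' by the closure of R, and each step on the right costs one iteration.
module Submission where

open import Defs
open import Data.Nat using (ℕ; zero; suc; _<_; z≤n; s≤s; _≟_; _+_)
open import Data.Nat.Properties using (+-suc; +-identityʳ)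
open import Data.Bool using (if_then_else_)
open import Data.Fin using (Fin; toℕ; zero; suc)
open import Data.Fin.Properties using (toℕ<n)
open import Data.List using (List; []; _∷_; _++_; [_]; length; map; foldl; lookup)
open import Data.List.Relation.Unary.Unique.Propositional using (Unique)
open import Data.List.Relation.Binary.Pointwise as Pointwise
  using (Pointwise; []; _∷_; ++⁺; Pointwise-length)
open import Data.Product using (Σ; _×_; _,_; proj₁; proj₂)
open import Data.Unit using (⊤; tt)
open import Data.Empty using (⊥)
open import Relation.Nullary using (¬_; yes; no; does)
open import Relation.Nullary.Decidable using (dec-true; dec-false)
open import Relation.Binary.PropositionalEquality using (_≡_; refl; sym; trans; cong; _≗_)
open import Relation.Binary.Construct.Closure.ReflexiveTransitive using (ε; _◅_; _◅◅_)

-- Labels and agreement of terms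

NotVar : Label → Set
NotVar (var x) = ⊥
NotVar _       = ⊤

NotVar-resp : ∀ {l l'} → l ≡ l' → NotVar l → NotVar l'
NotVar-resp refl n = n

data VarView (l : Label) : Set where
  is-var  : ∀ x → l ≡ var x → VarView l
  not-var : NotVar l → VarView l

var? : ∀ l → VarView l
var? (var x)  = is-var x refl
var? (con c)  = not-var tt
var? lam      = not-var tt
var? app      = not-var tt
var? (case _) = not-var tt

arity⇒NotVar : ∀ {l i} → i < arity l → NotVar l
arity⇒NotVar {var _}  ()
arity⇒NotVar {con _}  ()
arity⇒NotVar {lam}    _ = tt
arity⇒NotVar {app}    _ = tt
arity⇒NotVar {case _} _ = tt

arity-resp : ∀ {l l' i} → l ≡ l' → i < arity l → i < arity l'
arity-resp refl lt = lt

-- Substitution reads labels at junk positions below every non-variable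
-- node, so the equality it respects is agreement at all positions reached
-- through non-variable nodes, which is finer than _≈_.
NonVarPath : Term → List ℕ → Set
NonVarPath t []      = ⊤
NonVarPath t (i ∷ p) = NotVar (t []) × NonVarPath (child t i) p

infix 4 _≃_
_≃_ : Term → Term → Set
t ≃ u = ∀ p → NonVarPath t p → t p ≡ u p

child-≃ : ∀ {t u} → t ≃ u → NotVar (t []) → ∀ i → child t i ≃ child u i
child-≃ e n i q nq = e (i ∷ q) (n , nq)

NonVarPath-≃ : ∀ {t u} → t ≃ u → ∀ p → NonVarPath t p → NonVarPath u p
NonVarPath-≃ e []      _        = tt
NonVarPath-≃ e (i ∷ p) (n , np) = NotVar-resp (e [] tt) n , NonVarPath-≃ (child-≃ e n i) p np

≃-refl : ∀ {t} → t ≃ t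
≃-refl p _ = refl

≃-sym : ∀ {t u} → t ≃ u → u ≃ t
≃-sym {t} {u} e p np = sym (e p (reflect e p np))
  where
  reflect : ∀ {t u} → t ≃ u → ∀ p → NonVarPath u p → NonVarPath t p
  reflect e []      _        = tt
  reflect e (i ∷ p) (n , np) =
    let n' = NotVar-resp (sym (e [] tt)) n in n' , reflect (child-≃ e n' i) p np

≃-trans : ∀ {t u v} → t ≃ u → u ≃ v → t ≃ v
≃-trans e e' p np = trans (e p np) (e' p (NonVarPath-≃ e p np))

≗⇒≃ : ∀ {t u} → t ≗ u → t ≃ u
≗⇒≃ e p _ = e p

Valid⇒NonVarPath : ∀ t p → Valid t p → NonVarPath t p
Valid⇒NonVarPath t []      _         = tt
Valid⇒NonVarPath t (i ∷ p) (lt , vp) = arity⇒NotVar lt , Valid⇒NonVarPath (child t i) p vp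

≃⇒≈ : ∀ {t u} → t ≃ u → t ≈ u
≃⇒≈ {t} e p vp = e p (Valid⇒NonVarPath t p vp)

child-≈ : ∀ {t u i} → t ≈ u → i < arity (t []) → child t i ≈ child u i
child-≈ {i = i} e lt q vq = e (i ∷ q) (lt , vq)

Valid-≈ : ∀ {t u} → t ≈ u → ∀ p → Valid t p → Valid u p
Valid-≈ e []      _         = tt
Valid-≈ e (i ∷ p) (lt , vp) = arity-resp (e [] tt) lt , Valid-≈ (child-≈ e lt) p vp

≈-refl : ∀ {t} → t ≈ t
≈-refl p _ = refl

≈-sym : ∀ {t u} → t ≈ u → u ≈ t
≈-sym {t} {u} e p vp = sym (e p (reflect e p vp))
  where
  reflect : ∀ {t u} → t ≈ u → ∀ p → Valid u p → Valid t p
  reflect e []      _         = tt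
  reflect e (i ∷ p) (lt , vp) =
    let lt' = arity-resp (sym (e [] tt)) lt in lt' , reflect (child-≈ e lt') p vp

≈-trans : ∀ {t u v} → t ≈ u → u ≈ v → t ≈ v
≈-trans e e' p vp = trans (e p vp) (e' p (Valid-≈ e p vp))

-- Renaming and substitution

relabel-NotVar : ∀ ρ {l} → NotVar l → relabel ρ l ≡ l
relabel-NotVar ρ {var _}  ()
relabel-NotVar ρ {con _}  _ = refl
relabel-NotVar ρ {lam}    _ = refl
relabel-NotVar ρ {app}    _ = refl
relabel-NotVar ρ {case _} _ = refl

NotVar-relabel⁻ : ∀ ρ l → NotVar (relabel ρ l) → NotVar l
NotVar-relabel⁻ ρ (var _)  ()
NotVar-relabel⁻ ρ (con _)  _ = tt
NotVar-relabel⁻ ρ lam      _ = tt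
NotVar-relabel⁻ ρ app      _ = tt
NotVar-relabel⁻ ρ (case _) _ = tt

binds-relabel : ∀ ρ l i → binds (relabel ρ l) i ≡ binds l i
binds-relabel ρ (var _)  i = refl
binds-relabel ρ (con _)  i = refl
binds-relabel ρ lam      i = refl
binds-relabel ρ app      i = refl
binds-relabel ρ (case _) i = refl

relabel-cong : ∀ {ρ ρ'} → ρ ≗ ρ' → ∀ l → relabel ρ l ≡ relabel ρ' l
relabel-cong e (var x)  = cong var (e x)
relabel-cong e (con _)  = refl
relabel-cong e lam      = refl
relabel-cong e app      = refl
relabel-cong e (case _) = refl

relabel-∘ : ∀ {ρ ρ' ρ''} → (∀ x → ρ' (ρ x) ≡ ρ'' x) → ∀ l → relabel ρ' (relabel ρ l) ≡ relabel ρ'' l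
relabel-∘ h (var x)  = cong var (h x)
relabel-∘ h (con _)  = refl
relabel-∘ h lam      = refl
relabel-∘ h app      = refl
relabel-∘ h (case _) = refl

substL-[] : ∀ σ t {l} → NotVar l → substL σ t l [] ≡ l
substL-[] σ t {var _}  ()
substL-[] σ t {con _}  _ = refl
substL-[] σ t {lam}    _ = refl
substL-[] σ t {app}    _ = refl
substL-[] σ t {case _} _ = refl

substL-∷ : ∀ σ t {l} → NotVar l → ∀ i p →
           substL σ t l (i ∷ p) ≡ subst (liftˢⁿ (binds l i) σ) (child t i) p
substL-∷ σ t {var _}  ()
substL-∷ σ t {con _}  _ i p = refl
substL-∷ σ t {lam}    _ i p = refl
substL-∷ σ t {app}    _ i p = refl
substL-∷ σ t {case _} _ i p = refl

subst-var : ∀ σ t {x} → t [] ≡ var x → subst σ t ≗ σ x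
subst-var σ t e p = cong (λ l → substL σ t l p) e

subst-root : ∀ σ t {l} → t [] ≡ l → NotVar l → subst σ t [] ≡ l
subst-root σ t refl n = substL-[] σ t n

subst-child : ∀ σ t {l} → t [] ≡ l → NotVar l → ∀ i →
              child (subst σ t) i ≗ subst (liftˢⁿ (binds l i) σ) (child t i)
subst-child σ t refl n i = substL-∷ σ t n i

subst-child-≃ : ∀ σ t {l} → t [] ≡ l → NotVar l → ∀ i →
                subst (liftˢⁿ (binds l i) σ) (child t i) ≃ child (subst σ t) i
subst-child-≃ σ t e n i = ≃-sym (≗⇒≃ (subst-child σ t e n i))

vt-≃ : ∀ {t x} → t [] ≡ var x → vt x ≃ t
vt-≃ e []      _        = sym e
vt-≃ e (i ∷ p) (() , _)

rename-vt : ∀ ρ x → rename ρ (vt x) ≃ vt (ρ x)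
rename-vt ρ x []      _        = refl
rename-vt ρ x (i ∷ p) (() , _)

_≃ˢ_ : (ℕ → Term) → (ℕ → Term) → Set
σ ≃ˢ τ = ∀ x → σ x ≃ τ x

liftʳⁿ-cong : ∀ {n m ρ ρ'} → n ≡ m → ρ ≗ ρ' → liftʳⁿ n ρ ≗ liftʳⁿ m ρ'
liftʳⁿ-cong {zero}  refl e         = e
liftʳⁿ-cong {suc n} refl e zero    = refl
liftʳⁿ-cong {suc n} refl e (suc x) = cong suc (liftʳⁿ-cong {n} refl e x)

rename-cong : ∀ {ρ ρ'} → ρ ≗ ρ' → ∀ {t t'} → t ≃ t' → rename ρ t ≃ rename ρ' t'
rename-cong {ρ} {ρ'} e {t} {t'} te []      _        =
  trans (relabel-cong e (t [])) (cong (relabel ρ') (te [] tt))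
rename-cong {ρ} {ρ'} e {t} {t'} te (i ∷ p) (n , np) =
  rename-cong (liftʳⁿ-cong (cong (λ l → binds l i) (te [] tt)) e)
              (child-≃ te (NotVar-relabel⁻ ρ (t []) n) i) p np

liftˢⁿ-cong : ∀ {n m σ σ'} → n ≡ m → σ ≃ˢ σ' → liftˢⁿ n σ ≃ˢ liftˢⁿ m σ'
liftˢⁿ-cong {zero}  refl e         = e
liftˢⁿ-cong {suc n} refl e zero    = ≃-refl
liftˢⁿ-cong {suc n} refl e (suc x) = rename-cong (λ _ → refl) (liftˢⁿ-cong {n} refl e x)

subst-cong : ∀ {σ σ'} → σ ≃ˢ σ' → ∀ {t t'} → t ≃ t' → subst σ t ≃ subst σ' t'
subst-cong {σ} {σ'} e {t} {t'} te p np with var? (t [])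
... | is-var x ex =
  trans (subst-var σ t ex p)
    (trans (e x p (NonVarPath-≃ (≗⇒≃ (subst-var σ t ex)) p np))
      (sym (subst-var σ' t' (trans (sym (te [] tt)) ex) p)))
subst-cong {σ} {σ'} e {t} {t'} te [] _ | not-var n =
  trans (subst-root σ t refl n) (sym (subst-root σ' t' (sym (te [] tt)) n))
subst-cong {σ} {σ'} e {t} {t'} te (i ∷ q) (_ , nq) | not-var n =
  trans (subst-child σ t refl n i q)
    (trans (subst-cong (liftˢⁿ-cong {binds (t []) i} refl e) (child-≃ te n i) q
             (NonVarPath-≃ (≗⇒≃ (subst-child σ t refl n i)) q nq))
      (sym (subst-child σ' t' (sym (te [] tt)) n i q)))

subst-≈ : ∀ σ {t t'} → t ≈ t' → subst σ t ≈ subst σ t'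
subst-≈ σ {t} {t'} te p vp with var? (t [])
... | is-var x ex = trans (subst-var σ t ex p) (sym (subst-var σ t' (trans (sym (te [] tt)) ex) p))
subst-≈ σ {t} {t'} te [] _ | not-var n =
  trans (subst-root σ t refl n) (sym (subst-root σ t' (sym (te [] tt)) n))
subst-≈ σ {t} {t'} te (i ∷ q) (lt , vq) | not-var n =
  trans (subst-child σ t refl n i q)
    (trans (subst-≈ _ (child-≈ te (arity-resp (subst-root σ t refl n) lt)) q
             (Valid-≈ (≃⇒≈ (≗⇒≃ (subst-child σ t refl n i))) q vq))
      (sym (subst-child σ t' (sym (te [] tt)) n i q)))

liftʳⁿ-∘ : ∀ {n m ρ ρ' ρ''} → n ≡ m → (∀ x → ρ' (ρ x) ≡ ρ'' x) →
           ∀ x → liftʳⁿ m ρ' (liftʳⁿ n ρ x) ≡ liftʳⁿ n ρ'' x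
liftʳⁿ-∘ {zero}  refl h x       = h x
liftʳⁿ-∘ {suc n} refl h zero    = refl
liftʳⁿ-∘ {suc n} refl h (suc x) = cong suc (liftʳⁿ-∘ {n} refl h x)

rename-rename : ∀ {ρ ρ' ρ''} → (∀ x → ρ' (ρ x) ≡ ρ'' x) →
                ∀ t → rename ρ' (rename ρ t) ≃ rename ρ'' t
rename-rename h t []      _        = relabel-∘ h (t [])
rename-rename {ρ} h t (i ∷ p) (_ , np) =
  rename-rename (liftʳⁿ-∘ {binds (t []) i} (sym (binds-relabel ρ (t []) i)) h) (child t i) p np

liftˢⁿ-liftʳⁿ : ∀ {n m ρ τ τ'} → n ≡ m → (∀ x → τ (ρ x) ≃ τ' x) →
                ∀ x → liftˢⁿ m τ (liftʳⁿ n ρ x) ≃ liftˢⁿ n τ' x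
liftˢⁿ-liftʳⁿ {zero}  refl h x       = h x
liftˢⁿ-liftʳⁿ {suc n} refl h zero    = ≃-refl
liftˢⁿ-liftʳⁿ {suc n} refl h (suc x) = rename-cong (λ _ → refl) (liftˢⁿ-liftʳⁿ {n} refl h x)

subst-rename : ∀ {ρ τ τ'} → (∀ x → τ (ρ x) ≃ τ' x) → ∀ t → subst τ (rename ρ t) ≃ subst τ' t
subst-rename {ρ} {τ} {τ'} h t with var? (t [])
... | is-var x ex =
  ≃-trans (≗⇒≃ (subst-var τ (rename ρ t) (cong (relabel ρ) ex)))
    (≃-trans (h x) (≃-sym (≗⇒≃ (subst-var τ' t ex))))
... | not-var n = go
  where
  root : rename ρ t [] ≡ t []
  root = relabel-NotVar ρ n
  n' : NotVar (rename ρ t [])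
  n' = NotVar-resp (sym root) n
  go : subst τ (rename ρ t) ≃ subst τ' t
  go []      _        = trans (subst-root τ (rename ρ t) root n) (sym (subst-root τ' t refl n))
  go (i ∷ q) (_ , nq) =
    trans (subst-child τ (rename ρ t) refl n' i q)
      (trans (subst-rename (liftˢⁿ-liftʳⁿ {binds (t []) i} (sym (binds-relabel ρ (t []) i)) h) (child t i) q
               (NonVarPath-≃ (≗⇒≃ (subst-child τ (rename ρ t) refl n' i)) q nq))
        (sym (subst-child τ' t refl n i q)))

rename-liftˢⁿ : ∀ n {ρ σ σ'} → (∀ x → rename ρ (σ x) ≃ σ' x) →
                ∀ x → rename (liftʳⁿ n ρ) (liftˢⁿ n σ x) ≃ liftˢⁿ n σ' x
rename-liftˢⁿ zero    h x       = h x
rename-liftˢⁿ (suc n) h zero    = rename-vt _ zero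
rename-liftˢⁿ (suc n) {ρ} {σ} h (suc x) =
  ≃-trans (rename-rename (λ _ → refl) (liftˢⁿ n σ x))
    (≃-trans (≃-sym (rename-rename {liftʳⁿ n ρ} {suc} (λ _ → refl) (liftˢⁿ n σ x)))
      (rename-cong (λ _ → refl) (rename-liftˢⁿ n h x)))

rename-subst : ∀ {ρ σ σ'} → (∀ x → rename ρ (σ x) ≃ σ' x) → ∀ t → rename ρ (subst σ t) ≃ subst σ' t
rename-subst {ρ} {σ} {σ'} h t with var? (t [])
... | is-var x ex =
  ≃-trans (rename-cong (λ _ → refl) (≗⇒≃ (subst-var σ t ex)))
    (≃-trans (h x) (≃-sym (≗⇒≃ (subst-var σ' t ex))))
... | not-var n = go
  where
  root : subst σ t [] ≡ t []
  root = subst-root σ t refl n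
  go : rename ρ (subst σ t) ≃ subst σ' t
  go []      _        = trans (cong (relabel ρ) root)
                          (trans (relabel-NotVar ρ n) (sym (subst-root σ' t refl n)))
  go (i ∷ q) (_ , nq) =
    trans (pushed q nq)
      (trans (rename-subst (rename-liftˢⁿ (binds (t []) i) h) (child t i) q (NonVarPath-≃ pushed q nq))
        (sym (subst-child σ' t refl n i q)))
    where
    pushed : rename (liftʳⁿ (binds (subst σ t []) i) ρ) (child (subst σ t) i)
             ≃ rename (liftʳⁿ (binds (t []) i) ρ) (subst (liftˢⁿ (binds (t []) i) σ) (child t i))
    pushed = rename-cong (liftʳⁿ-cong (cong (λ l → binds l i) root) (λ _ → refl))
                         (≗⇒≃ (subst-child σ t refl n i))

subst-liftˢⁿ : ∀ n {σ τ ν} → (∀ x → subst τ (σ x) ≃ ν x) →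
               ∀ x → subst (liftˢⁿ n τ) (liftˢⁿ n σ x) ≃ liftˢⁿ n ν x
subst-liftˢⁿ zero    h x       = h x
subst-liftˢⁿ (suc n) {τ = τ} h zero = ≗⇒≃ (subst-var (liftˢ (liftˢⁿ n τ)) (vt zero) refl)
subst-liftˢⁿ (suc n) {σ} {τ} h (suc x) =
  ≃-trans (subst-rename (λ _ → ≃-refl) (liftˢⁿ n σ x))
    (≃-trans (≃-sym (rename-subst {suc} {liftˢⁿ n τ} (λ _ → ≃-refl) (liftˢⁿ n σ x)))
      (rename-cong (λ _ → refl) (subst-liftˢⁿ n h x)))

subst-subst : ∀ {σ τ ν} → (∀ x → subst τ (σ x) ≃ ν x) → ∀ t → subst τ (subst σ t) ≃ subst ν t
subst-subst {σ} {τ} {ν} h t with var? (t [])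
... | is-var x ex =
  ≃-trans (subst-cong (λ _ → ≃-refl) (≗⇒≃ (subst-var σ t ex)))
    (≃-trans (h x) (≃-sym (≗⇒≃ (subst-var ν t ex))))
... | not-var n = go
  where
  root : subst σ t [] ≡ t []
  root = subst-root σ t refl n
  n' : NotVar (subst σ t [])
  n' = NotVar-resp (sym root) n
  go : subst τ (subst σ t) ≃ subst ν t
  go []      _        = trans (subst-root τ (subst σ t) root n) (sym (subst-root ν t refl n))
  go (i ∷ q) (_ , nq) =
    trans (subst-child τ (subst σ t) refl n' i q)
      (trans (pushed q nq')
        (trans (subst-subst (subst-liftˢⁿ (binds (t []) i) h) (child t i) q (NonVarPath-≃ pushed q nq'))
          (sym (subst-child ν t refl n i q))))
    where
    pushed : subst (liftˢⁿ (binds (subst σ t []) i) τ) (child (subst σ t) i)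
             ≃ subst (liftˢⁿ (binds (t []) i) τ) (subst (liftˢⁿ (binds (t []) i) σ) (child t i))
    pushed = subst-cong (liftˢⁿ-cong (cong (λ l → binds l i) root) (λ _ → ≃-refl))
                        (≗⇒≃ (subst-child σ t refl n i))
    nq' = NonVarPath-≃ (≗⇒≃ (subst-child τ (subst σ t) refl n' i)) q nq

liftˢⁿ-vt : ∀ n {σ} → (∀ x → σ x ≃ vt x) → ∀ x → liftˢⁿ n σ x ≃ vt x
liftˢⁿ-vt zero    h x       = h x
liftˢⁿ-vt (suc n) h zero    = ≃-refl
liftˢⁿ-vt (suc n) h (suc x) = ≃-trans (rename-cong (λ _ → refl) (liftˢⁿ-vt n h x)) (rename-vt suc x)

subst-id : ∀ {σ} → (∀ x → σ x ≃ vt x) → ∀ t → subst σ t ≃ t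
subst-id {σ} h t with var? (t [])
... | is-var x ex = ≃-trans (≗⇒≃ (subst-var σ t ex)) (≃-trans (h x) (vt-≃ ex))
... | not-var n = go
  where
  go : subst σ t ≃ t
  go []      _        = subst-root σ t refl n
  go (i ∷ q) (_ , nq) =
    trans (subst-child σ t refl n i q)
      (subst-id (liftˢⁿ-vt (binds (t []) i) h) (child t i) q
        (NonVarPath-≃ (≗⇒≃ (subst-child σ t refl n i)) q nq))

subst-vt : ∀ t → subst vt t ≃ t
subst-vt = subst-id (λ _ → ≃-refl)

rename-suc-as-subst : ∀ u → subst (λ x → vt (suc x)) u ≃ rename suc u
rename-suc-as-subst u = ≃-trans (≃-sym (subst-rename (λ _ → ≃-refl) u)) (subst-vt (rename suc u))

extend : (ℕ → Term) → List Term → ℕ → Term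
extend σ us = foldl (λ σ u → u ∷ˢ σ) σ us

env : List Term → ℕ → Term
env = extend vt

extend-rel : ∀ (Q : Term → Term → Set) {σ σ'} → (∀ x → Q (σ x) (σ' x)) →
             ∀ {us us'} → Pointwise Q us us' → ∀ x → Q (extend σ us x) (extend σ' us' x)
extend-rel Q h []                     = h
extend-rel Q {σ} {σ'} h {u ∷ _} {u' ∷ _} (q ∷ qs) = extend-rel Q h' qs
  where
  h' : ∀ x → Q ((u ∷ˢ σ) x) ((u' ∷ˢ σ') x)
  h' zero    = q
  h' (suc x) = h x

env-cong : ∀ {us us'} → Pointwise _≃_ us us' → env us ≃ˢ env us'
env-cong = extend-rel _≃_ (λ _ → ≃-refl)

subst-extend : ∀ τ m {σ σ'} → (∀ x → subst τ (σ x) ≃ subst σ' (liftˢⁿ m τ x)) →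
               ∀ {us us'} → Pointwise (λ u u' → subst τ u ≃ u') us us' →
               ∀ x → subst τ (extend σ us x) ≃ subst (extend σ' us') (liftˢⁿ (m + length us) τ x)
subst-extend τ m h [] x =
  ≃-trans (h x) (subst-cong (λ _ → ≃-refl) (liftˢⁿ-cong (sym (+-identityʳ m)) (λ _ → ≃-refl) x))
subst-extend τ m {σ} {σ'} h {u ∷ us} {u' ∷ _} (q ∷ qs) x =
  ≃-trans (subst-extend τ (suc m) h' qs x)
    (subst-cong (λ _ → ≃-refl) (liftˢⁿ-cong (sym (+-suc m (length us))) (λ _ → ≃-refl) x))
  where
  h' : ∀ x → subst τ ((u ∷ˢ σ) x) ≃ subst (u' ∷ˢ σ') (liftˢⁿ (suc m) τ x)
  h' zero    = ≃-trans q (≃-sym (≗⇒≃ (subst-var (u' ∷ˢ σ') (vt zero) refl)))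
  h' (suc y) = ≃-trans (h y) (≃-sym (subst-rename (λ _ → ≃-refl) (liftˢⁿ m τ y)))

subst-env : ∀ τ {us us'} → Pointwise (λ u u' → subst τ u ≃ u') us us' →
            ∀ x → subst τ (env us x) ≃ subst (env us') (liftˢⁿ (length us) τ x)
subst-env τ = subst-extend τ 0 λ x →
  ≃-trans (≗⇒≃ (subst-var τ (vt x) refl)) (≃-sym (subst-vt (τ x)))

subst-[]ₙ : ∀ τ t {us us'} → Pointwise (λ u u' → subst τ u ≃ u') us us' →
            subst τ (t [ us ]ₙ) ≃ subst (liftˢⁿ (length us) τ) t [ us' ]ₙ
subst-[]ₙ τ t qs =
  ≃-trans (subst-subst (λ _ → ≃-refl) t) (≃-sym (subst-subst (λ x → ≃-sym (subst-env τ qs x)) t))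

Spine-≃ : ∀ {t t' c us} → Spine t c us → t ≃ t' →
          Σ (List Term) λ us' → Spine t' c us' × Pointwise _≃_ us us'
Spine-≃ (head e) tt' = [] , head (trans (sym (tt' [] tt)) e) , []
Spine-≃ {t} {t'} (arg e sp) tt' with Spine-≃ sp (child-≃ tt' (NotVar-resp (sym e) tt) 0)
... | us' , sp' , qs = us' ++ [ child t' 1 ] , arg (trans (sym (tt' [] tt)) e) sp' ,
                       ++⁺ qs (child-≃ tt' (NotVar-resp (sym e) tt) 1 ∷ [])

Spine-subst : ∀ {t c us} → Spine t c us → ∀ τ →
              Σ (List Term) λ us' → Spine (subst τ t) c us' × Pointwise (λ u u' → subst τ u ≃ u') us us'
Spine-subst {t} (head e) τ = [] , head (subst-root τ t e tt) , []
Spine-subst {t} (arg e sp) τ with Spine-subst sp τ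
... | us₁ , sp₁ , qs₁ with Spine-≃ sp₁ (subst-child-≃ τ t e tt 0)
... | us₂ , sp₂ , qs₂ = us₂ ++ [ child (subst τ t) 1 ] , arg (subst-root τ t e tt) sp₂ ,
                        ++⁺ (Pointwise.transitive ≃-trans qs₁ qs₂) (subst-child-≃ τ t e tt 1 ∷ [])

nth-arity-lookup : ∀ cs (k : Fin (length cs)) {c n} → lookup cs k ≡ (c , n) → nth-arity cs (toℕ k) ≡ n
nth-arity-lookup (_ ∷ cs) zero    e = cong proj₂ e
nth-arity-lookup (_ ∷ cs) (suc k) e = nth-arity-lookup cs k e

-- Reduction under agreement, substitution and contexts

⟶-respʳ-≈ : ∀ {t u u'} → t ⟶ u → u ≈ u' → t ⟶ u'
⟶-respʳ-≈ (β e e₀ r)           uu = β e e₀ (≈-trans (≈-sym uu) r)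
⟶-respʳ-≈ (ι e uq sp k lk r)   uu = ι e uq sp k lk (≈-trans (≈-sym uu) r)
⟶-respʳ-≈ (ctx i e lt st same) uu =
  ctx i (trans e (uu [] tt)) lt (⟶-respʳ-≈ st (child-≈ uu (arity-resp e lt)))
      (λ j lj j≢i → ≈-trans (same j lj j≢i) (child-≈ uu (arity-resp e lj)))

⟶-respˡ-≃ : ∀ {t t' u} → t ≃ t' → t ⟶ u → t' ⟶ u
⟶-respˡ-≃ tt' (β e e₀ r) =
  β (trans (sym (tt' [] tt)) e) (trans (sym (tt' (0 ∷ []) (n , tt))) e₀)
    (≈-trans r (≃⇒≈ (subst-cong (env-cong (child-≃ tt' n 1 ∷ []))
                                (child-≃ (child-≃ tt' n 0) (NotVar-resp (sym e₀) tt) 0))))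
  where n = NotVar-resp (sym e) tt
⟶-respˡ-≃ tt' (ι {c = c} e uq sp k lk r) with Spine-≃ sp (child-≃ tt' (NotVar-resp (sym e) tt) 0)
... | us' , sp' , qs =
  ι (trans (sym (tt' [] tt)) e) uq sp' k (trans lk (cong (c ,_) (Pointwise-length qs)))
    (≈-trans r (≃⇒≈ (subst-cong (env-cong qs) (child-≃ tt' (NotVar-resp (sym e) tt) (suc (toℕ k))))))
⟶-respˡ-≃ tt' (ctx i e lt st same) =
  ctx i (trans (sym (tt' [] tt)) e) (arity-resp (tt' [] tt) lt) (⟶-respˡ-≃ (child-≃ tt' n i) st)
      (λ j lj j≢i → ≈-trans (≈-sym (≃⇒≈ (child-≃ tt' n j))) (same j (arity-resp (sym (tt' [] tt)) lj) j≢i))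
  where n = arity⇒NotVar lt

⟶*-respˡ-≃ : ∀ {t t' s} → t ≃ t' → t ⟶* s → Σ Term λ s' → t' ⟶* s' × s ≃ s'
⟶*-respˡ-≃ {t' = t'} e ε          = t' , ε , e
⟶*-respˡ-≃ {s = s}   e (st ◅ sts) = s , ⟶-respˡ-≃ e st ◅ sts , ≃-refl

subst-β : ∀ {t u} τ → t [] ≡ app → child t 0 [] ≡ lam →
          u ≈ (child (child t 0) 0 [ child t 1 ]₀) → subst τ t ⟶ subst τ u
subst-β {t} {u} τ e e₀ r = β (subst-root τ t e tt) root₀
  (≈-trans (subst-≈ τ r) (≃⇒≈ (≃-trans (subst-[]ₙ τ (child (child t 0) 0) (≃-refl ∷ []))
                                        (subst-cong (env-cong (operand ∷ [])) body))))
  where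
  root₀ : child (subst τ t) 0 [] ≡ lam
  root₀ = trans (subst-child τ t e tt 0 []) (subst-root τ (child t 0) e₀ tt)
  operand : subst τ (child t 1) ≃ child (subst τ t) 1
  operand = subst-child-≃ τ t e tt 1
  body : subst (liftˢ τ) (child (child t 0) 0) ≃ child (child (subst τ t) 0) 0
  body = ≃-sym (≗⇒≃ λ p → trans (subst-child τ t e tt 0 (0 ∷ p)) (subst-child τ (child t 0) e₀ tt 0 p))

subst-ι : ∀ {t u cs c us} τ → t [] ≡ case cs → Unique (map proj₁ cs) → Spine (child t 0) c us →
          (k : Fin (length cs)) → lookup cs k ≡ (c , length us) →
          u ≈ (child t (suc (toℕ k)) [ us ]ₙ) → subst τ t ⟶ subst τ u
subst-ι {t} {u} {cs} {c} {us} τ e uq sp k lk r with Spine-subst sp τ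
... | us₁ , sp₁ , qs₁ with Spine-≃ sp₁ (subst-child-≃ τ t e tt 0)
... | us₂ , sp₂ , qs₂ =
  ι (subst-root τ t e tt) uq sp₂ k (trans lk (cong (c ,_) (Pointwise-length qs)))
    (≈-trans (subst-≈ τ r) (≃⇒≈ (≃-trans (subst-[]ₙ τ branch qs) (subst-cong (λ _ → ≃-refl) branch'))))
  where
  qs = Pointwise.transitive ≃-trans qs₁ qs₂
  branch = child t (suc (toℕ k))
  branch' : subst (liftˢⁿ (length us) τ) branch ≃ child (subst τ t) (suc (toℕ k))
  branch' = ≃-trans (subst-cong (liftˢⁿ-cong (sym (nth-arity-lookup cs k lk)) (λ _ → ≃-refl)) (≃-refl {branch}))
                    (subst-child-≃ τ t e tt (suc (toℕ k)))

subst-⟶ : ∀ {t u} τ → t ⟶ u → subst τ t ⟶ subst τ u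
subst-⟶ {t} {u} τ (β e e₀ r)         = subst-β {t} {u} τ e e₀ r
subst-⟶ {t} {u} τ (ι e uq sp k lk r) = subst-ι {t} {u} τ e uq sp k lk r
subst-⟶ {t} {u} τ (ctx i e lt st same) =
  ctx i root (arity-resp (sym (subst-root τ t refl n)) lt)
      (⟶-respʳ-≈ (⟶-respˡ-≃ (subst-child-≃ τ t refl n i) (subst-⟶ _ st))
                 (≃⇒≈ (subst-child-≃ τ u (sym e) n i)))
      same'
  where
  n = arity⇒NotVar lt
  root : subst τ t [] ≡ subst τ u []
  root = trans (subst-root τ t refl n) (sym (subst-root τ u (sym e) n))
  same' : ∀ j → j < arity (subst τ t []) → ¬ j ≡ i → child (subst τ t) j ≈ child (subst τ u) j
  same' j lj j≢i =
    ≈-trans (≃⇒≈ (≗⇒≃ (subst-child τ t refl n j)))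
      (≈-trans (subst-≈ _ (same j (arity-resp (subst-root τ t refl n) lj) j≢i))
               (≃⇒≈ (subst-child-≃ τ u (sym e) n j)))

subst-⟶* : ∀ {t u} τ → t ⟶* u → subst τ t ⟶* subst τ u
subst-⟶* τ ε          = ε
subst-⟶* τ (st ◅ sts) = subst-⟶ τ st ◅ subst-⟶* τ sts

graft : ℕ → Term → Term → Term
graft i t v []      = t []
graft i t v (j ∷ p) = if does (i ≟ j) then v p else t (j ∷ p)

graft-child : ∀ i t v → child (graft i t v) i ≗ v
graft-child i t v p rewrite dec-true (i ≟ i) refl = refl

graft-child-≢ : ∀ {i j} t v → ¬ j ≡ i → child (graft i t v) j ≗ child t j
graft-child-≢ {i} {j} t v j≢i p rewrite dec-false (i ≟ j) (λ i≡j → j≢i (sym i≡j)) = refl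

graft-child-self : ∀ i t v → child t i ≃ v → graft i t v ≃ t
graft-child-self i t v h []      _        = refl
graft-child-self i t v h (j ∷ q) (_ , nq) with j ≟ i
... | yes refl = trans (graft-child j t v q) (≃-sym h q (NonVarPath-≃ (≗⇒≃ (graft-child j t v)) q nq))
... | no j≢i   = graft-child-≢ t v j≢i q

graft-graft : ∀ i t v v' → graft i (graft i t v) v' ≗ graft i t v'
graft-graft i t v v' []      = refl
graft-graft i t v v' (j ∷ q) with j ≟ i
... | yes refl = trans (graft-child j (graft j t v) v' q) (sym (graft-child j t v' q))
... | no j≢i   = trans (graft-child-≢ (graft i t v) v' j≢i q)
                   (trans (graft-child-≢ t v j≢i q) (sym (graft-child-≢ t v' j≢i q)))

graft-⟶ : ∀ {i t v v'} → i < arity (t []) → child t i ≃ v → v ⟶ v' → t ⟶ graft i t v'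
graft-⟶ {i} {t} {v} {v'} lt h st =
  ctx i refl lt (⟶-respʳ-≈ (⟶-respˡ-≃ (≃-sym h) st) (≃⇒≈ (≃-sym (≗⇒≃ (graft-child i t v')))))
      (λ j _ j≢i → ≃⇒≈ (≃-sym (≗⇒≃ (graft-child-≢ t v' j≢i))))

graft-⟶* : ∀ {i t v v'} → i < arity (t []) → child t i ≃ v → v ⟶* v' →
           Σ Term λ w → t ⟶* w × graft i t v' ≃ w
graft-⟶* {i} {t} {v} lt h ε = t , ε , graft-child-self i t v h
graft-⟶* {i} {t} lt h (_◅_ {j = v₁} st sts) with graft-⟶* {i} {graft i t v₁} lt (≗⇒≃ (graft-child i t v₁)) sts
... | w , sts' , gw = w , graft-⟶ lt h st ◅ sts' , ≃-trans (≃-sym (≗⇒≃ (graft-graft i t v₁ _))) gw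

-- Post-fixed points and their up-to closure

TermRel : Set₁
TermRel = Term → Term → Set

PostFixed : TermRel → Set
PostFixed R = ∀ a b → R a b → Clauses R a b

ClauseAt : TermRel → Term → Term → Label → Set
ClauseAt Q a b (var x)   = Σ Term λ s → a ⟶* s × s [] ≡ var x
ClauseAt Q a b (con c)   = Σ Term λ s → a ⟶* s × s [] ≡ con c
ClauseAt Q a b lam       = Σ Term λ s → a ⟶* s × s [] ≡ lam × Q (child s 0) (child b 0)
ClauseAt Q a b app       = Σ Term λ s → a ⟶* s × s [] ≡ app ×
                             Q (child s 0) (child b 0) × Q (child s 1) (child b 1)
ClauseAt Q a b (case cs) = Σ Term λ s → a ⟶* s × s [] ≡ case cs × Q (child s 0) (child b 0) ×
                             (∀ k → k < length cs → Q (child s (suc k)) (child b (suc k)))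

unfold : ∀ {Q a b} → Clauses Q a b → ClauseAt Q a b (b [])
unfold (var e st es)         rewrite e = _ , st , es
unfold (con e st es)         rewrite e = _ , st , es
unfold (lam e st es q)       rewrite e = _ , st , es , q
unfold (app e st es q₀ q₁)   rewrite e = _ , st , es , q₀ , q₁
unfold (case e st es q₀ qs)  rewrite e = _ , st , es , q₀ , qs

unfold-at : ∀ {Q a b l} → Clauses Q a b → b [] ≡ l → ClauseAt Q a b l
unfold-at c refl = unfold c

Clauses-map : ∀ {P Q : TermRel} → (∀ {a b} → P a b → Q a b) → ∀ {a b} → Clauses P a b → Clauses Q a b
Clauses-map f (var e st es)        = var e st es
Clauses-map f (con e st es)        = con e st es
Clauses-map f (lam e st es q)      = lam e st es (f q)
Clauses-map f (app e st es q₀ q₁)  = app e st es (f q₀) (f q₁)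
Clauses-map f (case e st es q₀ qs) = case e st es (f q₀) (λ k lk → f (qs k lk))

Clauses-pre : ∀ {Q a a' b} → a ⟶* a' → Clauses Q a' b → Clauses Q a b
Clauses-pre st (var e st' es)        = var e (st ◅◅ st') es
Clauses-pre st (con e st' es)        = con e (st ◅◅ st') es
Clauses-pre st (lam e st' es q)      = lam e (st ◅◅ st') es q
Clauses-pre st (app e st' es q₀ q₁)  = app e (st ◅◅ st') es q₀ q₁
Clauses-pre st (case e st' es q₀ qs) = case e (st ◅◅ st') es q₀ qs

data Closure (R : TermRel) : TermRel where
  base     : ∀ {a b} → R a b → Closure R a b
  var-refl : ∀ x → Closure R (vt x) (vt x)
  sub      : ∀ {t t' σ σ'} → Closure R t t' → (∀ x → Closure R (σ x) (σ' x)) →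
             Closure R (subst σ t) (subst σ' t')
  resp     : ∀ {a b a' b'} → Closure R a b → a ≃ a' → b ≈ b' → Closure R a' b'
  pre      : ∀ {a a' b} → a ⟶* a' → Closure R a' b → Closure R a b
  fold     : ∀ {a b} → Clauses (Closure R) a b → Closure R a b

module _ {R : TermRel} where

  Closures-respˡ-≃ : ∀ {us us' vs} → Pointwise _≃_ us us' → Pointwise (Closure R) us vs →
                     Pointwise (Closure R) us' vs
  Closures-respˡ-≃ []       []       = []
  Closures-respˡ-≃ (e ∷ es) (q ∷ qs) = resp q e ≈-refl ∷ Closures-respˡ-≃ es qs

  Clauses-respˡ-≃ : ∀ {a a' b} → a ≃ a' → Clauses (Closure R) a b → Clauses (Closure R) a' b
  Clauses-respˡ-≃ aa (var e st es) with ⟶*-respˡ-≃ aa st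
  ... | _ , st' , ss = var e st' (trans (sym (ss [] tt)) es)
  Clauses-respˡ-≃ aa (con e st es) with ⟶*-respˡ-≃ aa st
  ... | _ , st' , ss = con e st' (trans (sym (ss [] tt)) es)
  Clauses-respˡ-≃ aa (lam e st es q) with ⟶*-respˡ-≃ aa st
  ... | _ , st' , ss = lam e st' (trans (sym (ss [] tt)) es) (resp q (child-≃ ss (NotVar-resp (sym es) tt) 0) ≈-refl)
  Clauses-respˡ-≃ aa (app e st es q₀ q₁) with ⟶*-respˡ-≃ aa st
  ... | _ , st' , ss = app e st' (trans (sym (ss [] tt)) es)
                         (resp q₀ (child-≃ ss (NotVar-resp (sym es) tt) 0) ≈-refl)
                         (resp q₁ (child-≃ ss (NotVar-resp (sym es) tt) 1) ≈-refl)
  Clauses-respˡ-≃ aa (case e st es q₀ qs) with ⟶*-respˡ-≃ aa st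
  ... | _ , st' , ss = case e st' (trans (sym (ss [] tt)) es)
                         (resp q₀ (child-≃ ss (NotVar-resp (sym es) tt) 0) ≈-refl)
                         (λ k lk → resp (qs k lk) (child-≃ ss (NotVar-resp (sym es) tt) (suc k)) ≈-refl)

  Clauses-respʳ-≈ : ∀ {a b b'} → b ≈ b' → Clauses (Closure R) a b → Clauses (Closure R) a b'
  Clauses-respʳ-≈ bb (var e st es) = var (trans (sym (bb [] tt)) e) st es
  Clauses-respʳ-≈ bb (con e st es) = con (trans (sym (bb [] tt)) e) st es
  Clauses-respʳ-≈ bb (lam e st es q) =
    lam (trans (sym (bb [] tt)) e) st es (resp q ≃-refl (child-≈ bb (arity-resp (sym e) (s≤s z≤n))))
  Clauses-respʳ-≈ bb (app e st es q₀ q₁) =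
    app (trans (sym (bb [] tt)) e) st es
        (resp q₀ ≃-refl (child-≈ bb (arity-resp (sym e) (s≤s z≤n))))
        (resp q₁ ≃-refl (child-≈ bb (arity-resp (sym e) (s≤s (s≤s z≤n)))))
  Clauses-respʳ-≈ bb (case e st es q₀ qs) =
    case (trans (sym (bb [] tt)) e) st es
         (resp q₀ ≃-refl (child-≈ bb (arity-resp (sym e) (s≤s z≤n))))
         (λ k lk → resp (qs k lk) ≃-refl (child-≈ bb (arity-resp (sym e) (s≤s lk))))

  Closure-liftˢⁿ : ∀ n {σ σ'} → (∀ x → Closure R (σ x) (σ' x)) →
                   ∀ x → Closure R (liftˢⁿ n σ x) (liftˢⁿ n σ' x)
  Closure-liftˢⁿ zero    h x       = h x
  Closure-liftˢⁿ (suc n) h zero    = var-refl zero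
  Closure-liftˢⁿ (suc n) {σ} {σ'} h (suc x) =
    resp (sub (Closure-liftˢⁿ n h x) (λ y → var-refl (suc y)))
         (rename-suc-as-subst (liftˢⁿ n σ x)) (≃⇒≈ (rename-suc-as-subst (liftˢⁿ n σ' x)))

  Clauses-subst : ∀ {t t' σ σ'} → Clauses (Closure R) t t' → (∀ x → Clauses (Closure R) (σ x) (σ' x)) →
                  (∀ x → Closure R (σ x) (σ' x)) → Clauses (Closure R) (subst σ t) (subst σ' t')
  Clauses-subst {t' = t'} {σ} {σ'} (var {s = s} e st es) cσ _ =
    Clauses-pre (subst-⟶* σ st)
      (Clauses-respˡ-≃ (≃-sym (≗⇒≃ (subst-var σ s es)))
        (Clauses-respʳ-≈ (≃⇒≈ (≃-sym (≗⇒≃ (subst-var σ' t' e)))) (cσ _)))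
  Clauses-subst {t' = t'} {σ} {σ'} (con {s = s} e st es) _ _ =
    con (subst-root σ' t' e tt) (subst-⟶* σ st) (subst-root σ s es tt)
  Clauses-subst {t' = t'} {σ} {σ'} (lam {s = s} e st es q) _ h =
    lam (subst-root σ' t' e tt) (subst-⟶* σ st) (subst-root σ s es tt)
      (resp (sub q (Closure-liftˢⁿ 1 h)) (subst-child-≃ σ s es tt 0) (≃⇒≈ (subst-child-≃ σ' t' e tt 0)))
  Clauses-subst {t' = t'} {σ} {σ'} (app {s = s} e st es q₀ q₁) _ h =
    app (subst-root σ' t' e tt) (subst-⟶* σ st) (subst-root σ s es tt)
      (resp (sub q₀ h) (subst-child-≃ σ s es tt 0) (≃⇒≈ (subst-child-≃ σ' t' e tt 0)))
      (resp (sub q₁ h) (subst-child-≃ σ s es tt 1) (≃⇒≈ (subst-child-≃ σ' t' e tt 1)))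
  Clauses-subst {t' = t'} {σ} {σ'} (case {cs = cs} {s = s} e st es q₀ qs) _ h =
    case (subst-root σ' t' e tt) (subst-⟶* σ st) (subst-root σ s es tt)
      (resp (sub q₀ h) (subst-child-≃ σ s es tt 0) (≃⇒≈ (subst-child-≃ σ' t' e tt 0)))
      (λ k lk → resp (sub (qs k lk) (Closure-liftˢⁿ (nth-arity cs k) h))
                     (subst-child-≃ σ s es tt (suc k)) (≃⇒≈ (subst-child-≃ σ' t' e tt (suc k))))

  Closure-postFixed : PostFixed R → PostFixed (Closure R)
  Closure-postFixed P _ _ = unfold-closure
    where
    unfold-closure : ∀ {a b} → Closure R a b → Clauses (Closure R) a b
    unfold-closure (base r)       = Clauses-map base (P _ _ r)
    unfold-closure (var-refl x)   = var refl ε refl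
    unfold-closure (sub q h)      = Clauses-subst (unfold-closure q) (λ x → unfold-closure (h x)) h
    unfold-closure (resp q aa bb) = Clauses-respʳ-≈ bb (Clauses-respˡ-≃ aa (unfold-closure q))
    unfold-closure (pre st q)     = Clauses-pre st (unfold-closure q)
    unfold-closure (fold c)       = c

module _ {R : TermRel} (P : PostFixed R) where

  Spine-simulate : ∀ {a a' c us'} → R a a' → Spine a' c us' →
                   Σ Term λ s → Σ (List Term) λ us → a ⟶* s × Spine s c us × Pointwise (Closure R) us us'
  Spine-simulate r (head e) with unfold-at (P _ _ r) e
  ... | s , st , es = s , [] , st , head es , []
  Spine-simulate r (arg e sp) with unfold-at (P _ _ r) e
  ... | s , st , es , r₀ , r₁ with Spine-simulate r₀ sp
  ... | s₀ , us , st₀ , sp₀ , qs₀ with graft-⟶* (arity-resp (sym es) (s≤s z≤n)) ≃-refl st₀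
  ... | w , stw , gw with Spine-≃ sp₀ (child-≃ gw (NotVar-resp (sym es) tt) 0)
  ... | us' , sp' , qs' =
    w , us' ++ [ child w 1 ] , st ◅◅ stw , arg (trans (sym (gw [] tt)) es) sp' ,
    ++⁺ (Closures-respˡ-≃ qs' qs₀)
        (resp (base r₁) (child-≃ gw (NotVar-resp (sym es) tt) 1) ≈-refl ∷ [])

  step-β : ∀ {t t' t''} → R t t' → t' [] ≡ app → child t' 0 [] ≡ lam →
           t'' ≈ (child (child t' 0) 0 [ child t' 1 ]₀) → Closure R t t''
  step-β r e e₀ r'' with unfold-at (P _ _ r) e
  ... | s₁ , st₁ , es₁ , r₀ , r₁ with unfold-at (P _ _ r₀) e₀
  ... | s₂ , st₂ , es₂ , r₂ with graft-⟶* (arity-resp (sym es₁) (s≤s z≤n)) ≃-refl st₂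
  ... | w , stw , gw =
    pre (st₁ ◅◅ stw ◅◅ (contract ◅ ε))
        (resp (sub (base r₂) (extend-rel (Closure R) var-refl (base r₁ ∷ []))) agree (≈-sym r''))
    where
    n₁ = NotVar-resp (sym es₁) tt
    contract : w ⟶ (child (child w 0) 0 [ child w 1 ]₀)
    contract = β (trans (sym (gw [] tt)) es₁) (trans (sym (gw (0 ∷ []) (n₁ , tt))) es₂) ≈-refl
    agree : subst (env [ child s₁ 1 ]) (child s₂ 0) ≃ (child (child w 0) 0 [ child w 1 ]₀)
    agree = subst-cong (env-cong (child-≃ gw n₁ 1 ∷ []))
                       (child-≃ (child-≃ gw n₁ 0) (NotVar-resp (sym es₂) tt) 0)

  step-ι : ∀ {t t' t'' cs c us} → R t t' → t' [] ≡ case cs → Unique (map proj₁ cs) →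
           Spine (child t' 0) c us → (k : Fin (length cs)) → lookup cs k ≡ (c , length us) →
           t'' ≈ (child t' (suc (toℕ k)) [ us ]ₙ) → Closure R t t''
  step-ι {c = c} r e uq sp k lk r'' with unfold-at (P _ _ r) e
  ... | s₁ , st₁ , es₁ , r₀ , rs with Spine-simulate r₀ sp
  ... | s₂ , us₂ , st₂ , sp₂ , qs₂ with graft-⟶* (arity-resp (sym es₁) (s≤s z≤n)) ≃-refl st₂
  ... | w , stw , gw with Spine-≃ sp₂ (child-≃ gw (NotVar-resp (sym es₁) tt) 0)
  ... | us₃ , sp₃ , qs₃ =
    pre (st₁ ◅◅ stw ◅◅ (contract ◅ ε))
        (resp (sub (base (rs (toℕ k) (toℕ<n k))) (extend-rel (Closure R) var-refl args))
              (subst-cong (λ _ → ≃-refl) (child-≃ gw (NotVar-resp (sym es₁) tt) (suc (toℕ k))))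
              (≈-sym r''))
    where
    args : Pointwise (Closure R) us₃ _
    args = Closures-respˡ-≃ qs₃ qs₂
    contract : w ⟶ (child w (suc (toℕ k)) [ us₃ ]ₙ)
    contract = ι (trans (sym (gw [] tt)) es₁) uq sp₃ k
                 (trans lk (cong (c ,_) (sym (Pointwise-length args)))) ≈-refl

  Closure-step : ∀ {t t' t''} → R t t' → t' ⟶ t'' → Closure R t t''
  Closure-step r (β e e₀ r'')         = step-β r e e₀ r''
  Closure-step r (ι e uq sp k lk r'') = step-ι r e uq sp k lk r''
  Closure-step {t} {t'} {t''} r (ctx i e lt st same) = fold (step-clause (P _ _ r))
    where
    step-child : ∀ {s} j → j < arity (t' []) → R (child s j) (child t' j) → Closure R (child s j) (child t'' j)
    step-child j lj rj with j ≟ i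
    ... | yes refl = Closure-step rj st
    ... | no j≢i   = resp (base rj) ≃-refl (same j lj j≢i)
    e' : ∀ {l} → t' [] ≡ l → t'' [] ≡ l
    e' = trans (sym e)
    step-clause : Clauses R t t' → Clauses (Closure R) t t''
    step-clause (var e₁ _ _) with arity-resp e₁ lt
    ... | ()
    step-clause (con e₁ _ _) with arity-resp e₁ lt
    ... | ()
    step-clause (lam {s = s} e₁ st₁ es q) =
      lam (e' e₁) st₁ es (step-child {s} 0 (arity-resp (sym e₁) (s≤s z≤n)) q)
    step-clause (app {s = s} e₁ st₁ es q₀ q₁) =
      app (e' e₁) st₁ es (step-child {s} 0 (arity-resp (sym e₁) (s≤s z≤n)) q₀)
                         (step-child {s} 1 (arity-resp (sym e₁) (s≤s (s≤s z≤n))) q₁)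
    step-clause (case {s = s} e₁ st₁ es q₀ qs) =
      case (e' e₁) st₁ es (step-child {s} 0 (arity-resp (sym e₁) (s≤s z≤n)) q₀)
                          (λ k lk → step-child {s} (suc k) (arity-resp (sym e₁) (s≤s lk)) (qs k lk))

Closureⁿ : ℕ → TermRel → TermRel
Closureⁿ zero    R = R
Closureⁿ (suc n) R = Closure (Closureⁿ n R)

Closureⁿ-postFixed : ∀ {R} → PostFixed R → ∀ n → PostFixed (Closureⁿ n R)
Closureⁿ-postFixed P zero    = P
Closureⁿ-postFixed P (suc n) = Closure-postFixed (Closureⁿ-postFixed P n)

Closure* : TermRel → TermRel
Closure* R a b = Σ ℕ λ n → Closureⁿ n R a b

Closure*-⟶* : ∀ {R} → PostFixed R → ∀ {a b c} → Closure* R a b → b ⟶* c → Closure* R a c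
Closure*-⟶* P q         ε          = q
Closure*-⟶* P (n , q) (st ◅ sts) = Closure*-⟶* P (suc n , Closure-step (Closureⁿ-postFixed P n) q st) sts

Composite : TermRel → TermRel → TermRel
Composite R₁ R₂ a c = Σ Term λ b → Closure* R₁ a b × R₂ b c

Composite-postFixed : ∀ {R₁ R₂} → PostFixed R₁ → PostFixed R₂ → PostFixed (Composite R₁ R₂)
Composite-postFixed {R₁} {R₂} P₁ P₂ a c (b , q , r) = go (P₂ b c r)
  where
  absorb : ∀ {s l} → b ⟶* s → s [] ≡ l → Σ ℕ λ m → ClauseAt (Closureⁿ m R₁) a s l
  absorb st es with Closure*-⟶* P₁ q st
  ... | m , q' = m , unfold-at (Closureⁿ-postFixed P₁ m _ _ q') es
  go : Clauses R₂ b c → Clauses (Composite R₁ R₂) a c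
  go (var e st es) with absorb st es
  ... | _ , _ , st' , es' = var e st' es'
  go (con e st es) with absorb st es
  ... | _ , _ , st' , es' = con e st' es'
  go (lam {s = s} e st es r₀) with absorb st es
  ... | m , _ , st' , es' , q₀ = lam e st' es' (child s 0 , (m , q₀) , r₀)
  go (app {s = s} e st es r₀ r₁) with absorb st es
  ... | m , _ , st' , es' , q₀ , q₁ = app e st' es' (child s 0 , (m , q₀) , r₀) (child s 1 , (m , q₁) , r₁)
  go (case {s = s} e st es r₀ rs) with absorb st es
  ... | m , _ , st' , es' , q₀ , qs =
    case e st' es' (child s 0 , (m , q₀) , r₀) (λ k lk → child s (suc k) , (m , qs k lk) , rs k lk)

lemma2p4 : ∀ (t t' t'' : Term) → t ⟶∞ t' → t' ⟶∞ t'' → t ⟶∞ t''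
lemma2p4 t t' t'' (R₁ , P₁ , r₁) (R₂ , P₂ , r₂) =
  Composite R₁ R₂ , Composite-postFixed P₁ P₂ , t' , (0 , r₁) , r₂
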